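{- Every graph $G$ with maximum degree at most 3 is contained in $H_1\boxtimes H_2$ for some windmills $H_1$ and $H_2$. In particular, $(\mathrm{tw}\boxtimes\mathrm{tw})(G)\leq (\mathrm{pw}\boxtimes\mathrm{pw})(G)\leq 2$ and $(\mathrm{td}\boxtimes\mathrm{td})(G)\leq 3$.
   Context: A windmill is a graph $W$ such that $\Delta(W-a)\leq 1$ for some vertex $a\in V(W)$. For a graph parameter $f\in\{\mathrm{tw},\mathrm{pw},\mathrm{td}\}$ (treewidth, pathwidth, treedepth), $(f\boxtimes f)(G)$ is the minimum integer $k$ such that $G$ is isomorphic to a subgraph of $H_1\boxtimes H_2$ for some graphs $H_1,H_2$ with $f(H_1)\leq k$ and $f(H_2)\leq k$. -}

module Defs where

open import Data.Nat using (ℕ; zero; suc; _+_; _≤_; _<_)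
open import Data.Bool using (Bool; true; false; if_then_else_; _∧_; _∨_; not)
open import Data.Fin using (Fin; zero; suc; inject₁; fromℕ; toℕ; _≟_)
open import Data.Fin.Properties using () renaming (_≟_ to _≟ᶠ_)
open import Data.List using (List; map; allFin)
open import Data.Nat.ListAction using (sum)
open import Data.Maybe using (Maybe; just; nothing; _>>=_)
open import Data.Product using (Σ; _×_; _,_; ∃; ∃-syntax; proj₁; proj₂)
open import Relation.Nullary using (¬_; Dec; yes; no)
open import Relation.Nullary.Decidable using (⌊_⌋)
open import Relation.Binary.PropositionalEquality using (_≡_; _≢_)
open import Relation.Binary.Construct.Closure.ReflexiveTransitive using (Star)
open import Function.Definitions using (Injective)

record Graph : Set where
  field
    n      : ℕ
    adj    : Fin n → Fin n → Bool
    sym    : ∀ u v → adj u v ≡ adj v u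
    irrefl : ∀ v → adj v v ≡ false

open Graph public

V : Graph → Set
V G = Fin (n G)

count : ∀ {m} → (Fin m → Bool) → ℕ
count {m} p = sum (map (λ x → if p x then 1 else 0) (allFin m))

deg : (G : Graph) → V G → ℕ
deg G v = count (adj G v)

MaxDegLeq : Graph → ℕ → Set
MaxDegLeq G d = ∀ v → deg G v ≤ d

degMinus : (G : Graph) → V G → V G → ℕ
degMinus G a v = count (λ u → adj G v u ∧ not ⌊ u ≟ᶠ a ⌋)

Windmill : Graph → Set
Windmill W = Σ (V W) λ a → ∀ v → v ≢ a → degMinus W a v ≤ 1

⊠-adj : (H₁ H₂ : Graph) → V H₁ × V H₂ → V H₁ × V H₂ → Set
⊠-adj H₁ H₂ (x , y) (x' , y') =
  ¬ ((x , y) ≡ (x' , y')) ×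
  ((x ≡ x' Data.Sum.⊎ adj H₁ x x' ≡ true) ×
   (y ≡ y' Data.Sum.⊎ adj H₂ y y' ≡ true))
  where import Data.Sum

SubgraphOfStrongProduct : Graph → Graph → Graph → Set
SubgraphOfStrongProduct G H₁ H₂ =
  Σ (V G → V H₁ × V H₂) λ f →
    Injective _≡_ _≡_ f ×
    (∀ u v → adj G u v ≡ true → ⊠-adj H₁ H₂ (f u) (f v))

StepIn : (T : Graph) → (V T → Bool) → V T → V T → Set
StepIn T S x y = S x ≡ true × S y ≡ true × adj T x y ≡ true

ConnectedIn : (T : Graph) → (V T → Bool) → Set
ConnectedIn T S =
  (∃[ t ] S t ≡ true) ×
  (∀ x y → S x ≡ true → S y ≡ true → Star (StepIn T S) x y)

Connected : Graph → Set
Connected T = ConnectedIn T (λ _ → true)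

Cycle : Graph → Set
Cycle T = Σ ℕ λ l → Σ (Fin (suc (suc (suc l))) → V T) λ c →
  Injective _≡_ _≡_ c ×
  (∀ (i : Fin (suc (suc l))) → adj T (c (inject₁ i)) (c (suc i)) ≡ true) ×
  (adj T (c (fromℕ (suc (suc l)))) (c zero) ≡ true)

IsTree : Graph → Set
IsTree T = Connected T × ¬ Cycle T

TwLeq : Graph → ℕ → Set
TwLeq H k =
  Σ Graph λ T → IsTree T ×
  Σ (V T → V H → Bool) λ B →
    (∀ v → ∃[ t ] B t v ≡ true) ×
    (∀ u v → adj H u v ≡ true → ∃[ t ] (B t u ≡ true × B t v ≡ true)) ×
    (∀ v → ConnectedIn T (λ t → B t v)) ×
    (∀ t → count (B t) ≤ suc k)

PwLeq : Graph → ℕ → Set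
PwLeq H k =
  Σ ℕ λ m → Σ (Fin m → V H → Bool) λ B →
    (∀ v → ∃[ i ] B i v ≡ true) ×
    (∀ u v → adj H u v ≡ true → ∃[ i ] (B i u ≡ true × B i v ≡ true)) ×
    (∀ v (i j l : Fin m) → toℕ i ≤ toℕ j → toℕ j ≤ toℕ l →
       B i v ≡ true → B l v ≡ true → B j v ≡ true) ×
    (∀ i → count (B i) ≤ suc k)

-- rooted forests on Fin m given by a parent function (nothing = root)
up : ∀ {m} → (Fin m → Maybe (Fin m)) → ℕ → Fin m → Maybe (Fin m)
up p zero    v = just v
up p (suc i) v = up p i v >>= p

Ancestor : ∀ {m} → (Fin m → Maybe (Fin m)) → Fin m → Fin m → Set
Ancestor p u v = ∃[ i ] up p i v ≡ just u

-- H ⊆ closure of a rooted forest of height ≤ k (height counts vertices;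
-- "up p k v ≡ nothing" says the root path of v has ≤ k vertices, which
-- also forces the parent function to be acyclic)
TdLeq : Graph → ℕ → Set
TdLeq H k =
  Σ (V H → Maybe (V H)) λ p →
    (∀ v → up p k v ≡ nothing) ×
    (∀ u v → adj H u v ≡ true → Ancestor p u v Data.Sum.⊎ Ancestor p v u)
  where import Data.Sum

ProdLeq : (Graph → ℕ → Set) → Graph → ℕ → Set
ProdLeq f G k =
  Σ Graph λ H₁ → Σ Graph λ H₂ →
    f H₁ k × f H₂ k × SubgraphOfStrongProduct G H₁ H₂

{-# OPTIONS --safe #-}
module Submission where

-- A 2-colouring of G minimising the number of monochromatic edges gives every vertex at
-- most one neighbour of its own colour: if v had s ≥ 2 of them and b = deg v − s ≤ 1 of the
-- other colour, recolouring v would change that number by b − s < 0 (Lovász).  Hence each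
-- colour class spans a matching, and adding an apex to a matching yields a windmill.  Put a
-- vertex v of the first colour at (v, apex) and one of the second colour at (apex, v): an edge
-- inside a class moves along one coordinate, an edge between the classes goes between the
-- apex and a vertex in both.  A windmill over a matching has the path decomposition with bags
-- {apex, u, w} for its matching edges, and the forest apex – lower end – upper end of height
-- 3.  Finally a path decomposition is a tree decomposition along a path.

open import Algebra.Bundles using (CommutativeRing)
open import Data.Bool using (Bool; true; false; if_then_else_; _∧_; _∨_; not; _xor_)
import Data.Bool.Properties as Bool
open import Data.Bool.Properties
  using (∧-identityʳ; ∧-comm; ∨-comm; xor-comm; xor-same; ¬-not; T-≡; T-∨; xor-∧-commutativeRing)
open import Data.Empty using (⊥; ⊥-elim)
open import Data.Fin using (Fin; zero; suc; toℕ; inject₁; fromℕ; fromℕ<) renaming (_<_ to _<ᶠ_)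
import Data.Fin.Properties as Fin
open import Data.Fin.Properties
  using (_≟_; any?; toℕ-injective; toℕ<n; toℕ-fromℕ<; toℕ-fromℕ; toℕ-inject₁)
  renaming (_<?_ to _<ᶠ?_; <-cmp to <ᶠ-cmp; <-asym to <ᶠ-asym)
open import Data.List using (tabulate)
open import Data.List.Properties using (map-tabulate)
open import Data.Maybe using (Maybe; just; nothing; fromMaybe; maybe′; _>>=_)
open import Data.Nat using (ℕ; zero; suc; _+_; _*_; _≤_; _<_; z≤n; s≤s; s≤s⁻¹; _<?_; _≡ᵇ_)
open import Data.Nat.DivMod using (_mod_; m<n⇒m%n≡m)
open import Data.Nat.Induction using (<-wellFounded)
import Data.Nat.ListAction as List
open import Data.Nat.Properties
  using (≤-refl; ≤-trans; ≤-antisym; ≤-reflexive; ≤-<-trans; ≤-total; ≮⇒≥; 1+n≰n; n≤1+n;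
         m≤n+m; m≤m+n; +-comm; +-suc; +-identityʳ; +-mono-≤; +-monoˡ-≤; +-mono-<; +-monoʳ-<;
         +-cancelˡ-≤; +-cancelʳ-<; *-identityˡ; *-identityʳ; *-distribʳ-+; m∸n+n≡m; suc-injective;
         m≢1+n+m; 1+n≢n; ≡ᵇ⇒≡; ≡⇒≡ᵇ; module ≤-Reasoning)
open import Data.Product using (Σ; _×_; _,_; proj₁; proj₂; ∃-syntax; swap)
open import Data.Sum using (_⊎_; inj₁; inj₂; [_,_])
import Data.Sum as Sum
open import Function using (id; _∘_)
open import Function.Bundles using (module Equivalence)
open import Induction.WellFounded using (Acc; acc)
open import Relation.Binary.Construct.Closure.ReflexiveTransitive using (Star; ε; _◅_)
import Relation.Binary.Construct.Closure.ReflexiveTransitive as Star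
open import Relation.Binary.Definitions using (tri<; tri≈; tri>)
open import Relation.Binary.PropositionalEquality
  using (_≡_; _≢_; refl; sym; trans; cong; cong₂; subst; subst₂; module ≡-Reasoning)
open import Relation.Nullary using (¬_; Dec; does; yes; no)
open import Relation.Nullary.Decidable using (⌊_⌋; _×-dec_; dec-true)

open import Algebra.Properties.CommutativeSemigroup
  (CommutativeRing.+-commutativeSemigroup xor-∧-commutativeRing) using (interchange)
open import Algebra.Properties.Semiring.Sum Data.Nat.Properties.+-*-semiring
  using (sum-syntax; sum-cong-≗; sum-replicate-zero; ∑-distrib-+; *-distribˡ-sum)
open import Defs renaming (sym to adj-sym)

-- Sums of indicators over Fin

⟦_⟧ : Bool → ℕ
⟦ b ⟧ = if b then 1 else 0

δ : ∀ {n} → Fin n → Fin n → ℕ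
δ i j = ⟦ does (i ≟ j) ⟧

count≡∑ : ∀ {m} (p : Fin m → Bool) → count p ≡ ∑[ i < m ] ⟦ p i ⟧
count≡∑ p = trans (cong List.sum (map-tabulate id (λ i → ⟦ p i ⟧))) (sum-tabulate (λ i → ⟦ p i ⟧))
  where
  sum-tabulate : ∀ {m} (f : Fin m → ℕ) → List.sum (tabulate f) ≡ ∑[ i < m ] f i
  sum-tabulate {zero}  f = refl
  sum-tabulate {suc m} f = cong (f zero +_) (sum-tabulate (λ i → f (suc i)))

∑-select : ∀ {n} (j : Fin n) (f : Fin n → ℕ) → ∑[ i < n ] (δ i j * f i) ≡ f j
∑-select {suc n} zero    f =
  trans (cong₂ _+_ (*-identityˡ (f zero)) (sum-replicate-zero n)) (+-identityʳ (f zero))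
∑-select {suc n} (suc j) f = ∑-select j (λ i → f (suc i))

∑-δ : ∀ {n} (j : Fin n) → ∑[ i < n ] δ i j ≡ 1
∑-δ {n} j =
  trans (sum-cong-≗ {n} {y = λ i → δ i j * 1} (λ i → sym (*-identityʳ _))) (∑-select j (λ _ → 1))

∑-mono-≤ : ∀ {n} {f g : Fin n → ℕ} → (∀ i → f i ≤ g i) → ∑[ i < n ] f i ≤ ∑[ i < n ] g i
∑-mono-≤ {zero}  _   = z≤n
∑-mono-≤ {suc n} f≤g = +-mono-≤ (f≤g zero) (∑-mono-≤ (λ i → f≤g (suc i)))

∑∑-distrib-+ : ∀ {m n} (f g : Fin m → Fin n → ℕ) →
  ∑[ i < m ] ∑[ j < n ] (f i j + g i j) ≡ ∑[ i < m ] ∑[ j < n ] f i j + ∑[ i < m ] ∑[ j < n ] g i j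
∑∑-distrib-+ {m} {n} f g =
  trans (sum-cong-≗ {m} (λ i → ∑-distrib-+ (f i) (g i)))
        (∑-distrib-+ (λ i → ∑[ j < n ] f i j) (λ i → ∑[ j < n ] g i j))

∑⟦⟧-positive : ∀ {n} (p : Fin n → Bool) {x} → p x ≡ true → 1 ≤ ∑[ i < n ] ⟦ p i ⟧
∑⟦⟧-positive {suc n} p {zero}  px =
  subst (λ b → 1 ≤ ⟦ b ⟧ + ∑[ i < n ] ⟦ p (suc i) ⟧) (sym px) (s≤s z≤n)
∑⟦⟧-positive {suc n} p {suc x} px = ≤-trans (∑⟦⟧-positive (λ i → p (suc i)) px) (m≤n+m _ _)

∑⟦⟧≥2 : ∀ {n} (p : Fin (suc n) → Bool) {y} →
  p zero ≡ true → p (suc y) ≡ true → 2 ≤ ∑[ i < suc n ] ⟦ p i ⟧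
∑⟦⟧≥2 {n} p p0 py =
  subst (λ b → 2 ≤ ⟦ b ⟧ + ∑[ i < n ] ⟦ p (suc i) ⟧) (sym p0)
        (s≤s (∑⟦⟧-positive (λ i → p (suc i)) py))

∑⟦⟧≤1⇒unique : ∀ {n} (p : Fin n → Bool) {x y} →
  ∑[ i < n ] ⟦ p i ⟧ ≤ 1 → p x ≡ true → p y ≡ true → x ≡ y
∑⟦⟧≤1⇒unique p {zero}  {zero}  _  _  _  = refl
∑⟦⟧≤1⇒unique p {zero}  {suc _} ≤1 px py = ⊥-elim (1+n≰n (≤-trans (∑⟦⟧≥2 p px py) ≤1))
∑⟦⟧≤1⇒unique p {suc _} {zero}  ≤1 px py = ⊥-elim (1+n≰n (≤-trans (∑⟦⟧≥2 p py px) ≤1))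
∑⟦⟧≤1⇒unique p {suc _} {suc _} ≤1 px py =
  cong suc (∑⟦⟧≤1⇒unique (λ i → p (suc i)) (≤-trans (m≤n+m _ _) ≤1) px py)

⟦∧⟧≤ : ∀ x y → ⟦ x ∧ y ⟧ ≤ ⟦ x ⟧
⟦∧⟧≤ false _     = z≤n
⟦∧⟧≤ true  false = z≤n
⟦∧⟧≤ true  true  = ≤-refl

-- Lovász's colouring

-- Pointwise form of monoEdges-flipAt: e is the adjacency of v and w, x says whether their
-- colours differ, and p, q whether v, w is the recoloured vertex.
flip-balance : ∀ e x p q → (p ∧ q ∧ e) ≡ false →
  ⟦ e ∧ not (x xor (p xor q)) ⟧ + (⟦ p ⟧ + ⟦ q ⟧) * ⟦ e ∧ not x ⟧ ≡
  ⟦ e ∧ not x ⟧ + (⟦ p ⟧ + ⟦ q ⟧) * ⟦ e ∧ x ⟧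
flip-balance false _     _     _     _  = refl
flip-balance true  false false false _  = refl
flip-balance true  true  false false _  = refl
flip-balance true  false true  false _  = refl
flip-balance true  true  true  false _  = refl
flip-balance true  false false true  _  = refl
flip-balance true  true  false true  _  = refl
flip-balance true  _     true  true  ()

module _ (G : Graph) where

  monoAdj biAdj : (V G → Bool) → V G → V G → Bool
  monoAdj c v w = adj G v w ∧ not (c v xor c w)
  biAdj   c v w = adj G v w ∧ (c v xor c w)

  monoDeg biDeg : (V G → Bool) → V G → ℕ
  monoDeg c v = ∑[ w < n G ] ⟦ monoAdj c v w ⟧
  biDeg   c v = ∑[ w < n G ] ⟦ biAdj c v w ⟧

  monoEdges : (V G → Bool) → ℕ
  monoEdges c = ∑[ v < n G ] monoDeg c v

  flipAt : (V G → Bool) → V G → V G → Bool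
  flipAt c v₀ v = c v xor does (v ≟ v₀)

  monoAdj-sym : ∀ c v w → monoAdj c v w ≡ monoAdj c w v
  monoAdj-sym c v w = cong₂ (λ e x → e ∧ not x) (adj-sym G v w) (xor-comm (c v) (c w))

  biAdj-sym : ∀ c v w → biAdj c v w ≡ biAdj c w v
  biAdj-sym c v w = cong₂ _∧_ (adj-sym G v w) (xor-comm (c v) (c w))

  monoDeg+biDeg≡deg : ∀ c v → monoDeg c v + biDeg c v ≡ deg G v
  monoDeg+biDeg≡deg c v = begin
    monoDeg c v + biDeg c v
      ≡⟨ ∑-distrib-+ (λ w → ⟦ monoAdj c v w ⟧) (λ w → ⟦ biAdj c v w ⟧) ⟨
    ∑[ w < n G ] (⟦ monoAdj c v w ⟧ + ⟦ biAdj c v w ⟧)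
      ≡⟨ sum-cong-≗ {n G} (λ w → split (adj G v w) (c v xor c w)) ⟩
    ∑[ w < n G ] ⟦ adj G v w ⟧
      ≡⟨ count≡∑ (adj G v) ⟨
    deg G v
      ∎
    where
    open ≡-Reasoning
    split : ∀ e x → ⟦ e ∧ not x ⟧ + ⟦ e ∧ x ⟧ ≡ ⟦ e ⟧
    split false _     = refl
    split true  false = refl
    split true  true  = refl

  module _ (v₀ : V G) where

    private
      N : ℕ
      N = n G

    ∑∑-incident : (X : V G → V G → ℕ) → (∀ v w → X v w ≡ X w v) →
      ∑[ v < N ] ∑[ w < N ] ((δ v v₀ + δ w v₀) * X v w) ≡ ∑[ w < N ] X v₀ w + ∑[ w < N ] X v₀ w
    ∑∑-incident X X-sym = begin
      ∑[ v < N ] ∑[ w < N ] ((δ v v₀ + δ w v₀) * X v w)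
        ≡⟨ sum-cong-≗ {N} (λ v → sum-cong-≗ {N} (λ w → *-distribʳ-+ (X v w) (δ v v₀) (δ w v₀))) ⟩
      ∑[ v < N ] ∑[ w < N ] (δ v v₀ * X v w + δ w v₀ * X v w)
        ≡⟨ ∑∑-distrib-+ (λ v w → δ v v₀ * X v w) (λ v w → δ w v₀ * X v w) ⟩
      ∑[ v < N ] ∑[ w < N ] (δ v v₀ * X v w) + ∑[ v < N ] ∑[ w < N ] (δ w v₀ * X v w)
        ≡⟨ cong₂ _+_ (sum-cong-≗ {N} (λ v → *-distribˡ-sum (δ v v₀) (X v)))
                     (sum-cong-≗ {N} (λ v → sym (∑-select v₀ (X v)))) ⟨
      ∑[ v < N ] (δ v v₀ * ∑[ w < N ] X v w) + ∑[ v < N ] X v v₀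
        ≡⟨ cong₂ _+_ (∑-select v₀ (λ v → ∑[ w < N ] X v w)) (sum-cong-≗ {N} (λ v → X-sym v v₀)) ⟩
      ∑[ w < N ] X v₀ w + ∑[ w < N ] X v₀ w
        ∎
      where open ≡-Reasoning

    monoEdges-flipAt : ∀ c →
      monoEdges (flipAt c v₀) + (monoDeg c v₀ + monoDeg c v₀) ≡ monoEdges c + (biDeg c v₀ + biDeg c v₀)
    monoEdges-flipAt c = begin
      monoEdges c′ + (monoDeg c v₀ + monoDeg c v₀)
        ≡⟨ cong (monoEdges c′ +_)
                (∑∑-incident (λ v w → ⟦ monoAdj c v w ⟧) (λ v w → cong ⟦_⟧ (monoAdj-sym c v w))) ⟨
      monoEdges c′ + ∑[ v < N ] ∑[ w < N ] (ι v w * ⟦ monoAdj c v w ⟧)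
        ≡⟨ ∑∑-distrib-+ (λ v w → ⟦ monoAdj c′ v w ⟧) (λ v w → ι v w * ⟦ monoAdj c v w ⟧) ⟨
      ∑[ v < N ] ∑[ w < N ] (⟦ monoAdj c′ v w ⟧ + ι v w * ⟦ monoAdj c v w ⟧)
        ≡⟨ sum-cong-≗ {N} (λ v → sum-cong-≗ {N} (λ w → balance v w)) ⟩
      ∑[ v < N ] ∑[ w < N ] (⟦ monoAdj c v w ⟧ + ι v w * ⟦ biAdj c v w ⟧)
        ≡⟨ ∑∑-distrib-+ (λ v w → ⟦ monoAdj c v w ⟧) (λ v w → ι v w * ⟦ biAdj c v w ⟧) ⟩
      monoEdges c + ∑[ v < N ] ∑[ w < N ] (ι v w * ⟦ biAdj c v w ⟧)
        ≡⟨ cong (monoEdges c +_)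
                (∑∑-incident (λ v w → ⟦ biAdj c v w ⟧) (λ v w → cong ⟦_⟧ (biAdj-sym c v w))) ⟩
      monoEdges c + (biDeg c v₀ + biDeg c v₀)
        ∎
      where
      open ≡-Reasoning
      c′ : V G → Bool
      c′ = flipAt c v₀
      ι : V G → V G → ℕ
      ι v w = δ v v₀ + δ w v₀
      not-both-v₀ : ∀ v w → (does (v ≟ v₀) ∧ does (w ≟ v₀) ∧ adj G v w) ≡ false
      not-both-v₀ v w with v ≟ v₀ | w ≟ v₀
      ... | yes refl | yes refl = irrefl G v₀
      ... | yes _    | no _     = refl
      ... | no _     | _        = refl
      balance : ∀ v w → ⟦ monoAdj c′ v w ⟧ + ι v w * ⟦ monoAdj c v w ⟧ ≡
                        ⟦ monoAdj c v w ⟧ + ι v w * ⟦ biAdj c v w ⟧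
      balance v w = trans
        (cong (λ x → ⟦ adj G v w ∧ not x ⟧ + ι v w * ⟦ monoAdj c v w ⟧)
              (interchange (c v) (does (v ≟ v₀)) (c w) (does (w ≟ v₀))))
        (flip-balance (adj G v w) (c v xor c w) (does (v ≟ v₀)) (does (w ≟ v₀)) (not-both-v₀ v w))

    monoEdges-flipAt-< : ∀ c → biDeg c v₀ < monoDeg c v₀ → monoEdges (flipAt c v₀) < monoEdges c
    monoEdges-flipAt-< c b<s =
      +-cancelʳ-< (monoDeg c v₀ + monoDeg c v₀) (monoEdges (flipAt c v₀)) (monoEdges c)
        (subst (_< monoEdges c + (monoDeg c v₀ + monoDeg c v₀)) (sym (monoEdges-flipAt c))
          (+-monoʳ-< (monoEdges c) (+-mono-< b<s b<s)))

lovász-colouring : ∀ G d → MaxDegLeq G (2 * d + 1) → Σ (V G → Bool) λ c → ∀ v → monoDeg G c v ≤ d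
lovász-colouring G d Δ≤ = improve (λ _ → false) (<-wellFounded _)
  where
  biDeg<monoDeg : ∀ c v → d < monoDeg G c v → biDeg G c v < monoDeg G c v
  biDeg<monoDeg c v d<s = ≤-<-trans (+-cancelˡ-≤ (suc d) (biDeg G c v) d (begin
    suc d + biDeg G c v          ≤⟨ +-monoˡ-≤ (biDeg G c v) d<s ⟩
    monoDeg G c v + biDeg G c v  ≡⟨ monoDeg+biDeg≡deg G c v ⟩
    deg G v                      ≤⟨ Δ≤ v ⟩
    2 * d + 1                    ≡⟨ +-comm (2 * d) 1 ⟩
    suc (d + (d + 0))            ≡⟨ cong (λ t → suc (d + t)) (+-identityʳ d) ⟩
    suc d + d                    ∎)) d<s
    where open ≤-Reasoning
  improve : ∀ c → Acc _<_ (monoEdges G c) → Σ (V G → Bool) λ c → ∀ v → monoDeg G c v ≤ d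
  improve c (acc smaller) with any? (λ v → d <? monoDeg G c v)
  ... | yes (v , d<s) = improve (flipAt G c v) (smaller (monoEdges-flipAt-< G v c (biDeg<monoDeg c v d<s)))
  ... | no  none      = c , λ v → ≮⇒≥ (λ d<s → none (v , d<s))

-- Cones over matchings

coneAdj : (M : Graph) → Fin (suc (n M)) → Fin (suc (n M)) → Bool
coneAdj M zero    zero    = false
coneAdj M zero    (suc _) = true
coneAdj M (suc _) zero    = true
coneAdj M (suc u) (suc w) = adj M u w

cone : Graph → Graph
cone M = record { n = suc (n M) ; adj = coneAdj M ; sym = cone-sym ; irrefl = cone-irrefl }
  where
  cone-sym : ∀ u w → coneAdj M u w ≡ coneAdj M w u
  cone-sym zero    zero    = refl
  cone-sym zero    (suc _) = refl
  cone-sym (suc _) zero    = refl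
  cone-sym (suc u) (suc w) = adj-sym M u w
  cone-irrefl : ∀ u → coneAdj M u u ≡ false
  cone-irrefl zero    = refl
  cone-irrefl (suc u) = irrefl M u

degMinus-cone-apex : ∀ M w → degMinus (cone M) zero (suc w) ≡ deg M w
degMinus-cone-apex M w = begin
  degMinus (cone M) zero (suc w)    ≡⟨ count≡∑ (λ u → coneAdj M (suc w) u ∧ not ⌊ u ≟ zero ⌋) ⟩
  ∑[ u < n M ] ⟦ adj M w u ∧ true ⟧  ≡⟨ sum-cong-≗ {n M} (cong ⟦_⟧ ∘ ∧-identityʳ ∘ adj M w) ⟩
  ∑[ u < n M ] ⟦ adj M w u ⟧         ≡⟨ count≡∑ (adj M w) ⟨
  deg M w                           ∎
  where open ≡-Reasoning

cone-windmill : ∀ M → MaxDegLeq M 1 → Windmill (cone M)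
cone-windmill M Δ≤1 = zero , λ where
  zero    0≢0 → ⊥-elim (0≢0 refl)
  (suc w) _   → subst (_≤ 1) (sym (degMinus-cone-apex M w)) (Δ≤1 w)

module _ (M : Graph) (Δ≤1 : MaxDegLeq M 1) where

  partner-unique : ∀ {u x y} → adj M u x ≡ true → adj M u y ≡ true → x ≡ y
  partner-unique {u} = ∑⟦⟧≤1⇒unique (adj M u) (subst (_≤ 1) (count≡∑ (adj M u)) (Δ≤1 u))

  LowerEdge : V M → V M → Set
  LowerEdge u w = adj M u w ≡ true × u <ᶠ w

  lowerEdge? : ∀ u w → Dec (LowerEdge u w)
  lowerEdge? u w = (adj M u w Bool.≟ true) ×-dec (u <ᶠ? w)

  lowerEdge-unique : ∀ {u u′ w} → LowerEdge u w → LowerEdge u′ w → u ≡ u′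
  lowerEdge-unique (uw , _) (u′w , _) = partner-unique (trans (adj-sym M _ _) uw) (trans (adj-sym M _ _) u′w)

  lowerEdge-no-chain : ∀ {u u′ w} → LowerEdge u w → ¬ LowerEdge u′ u
  lowerEdge-no-chain (uw , u<w) (u′u , u′<u) with partner-unique uw (trans (adj-sym M _ _) u′u)
  ... | refl = <ᶠ-asym u<w u′<u

  edge-oriented : ∀ {u w} → adj M u w ≡ true → LowerEdge u w ⊎ LowerEdge w u
  edge-oriented {u} {w} uw with <ᶠ-cmp u w
  ... | tri< u<w _ _ = inj₁ (uw , u<w)
  ... | tri> _ _ w<u = inj₂ (trans (adj-sym M w u) uw , w<u)
  ... | tri≈ _ refl _ with trans (sym uw) (irrefl M u)
  ...   | ()

  lowerPartner : V M → Maybe (V M)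
  lowerPartner w with any? (λ u → lowerEdge? u w)
  ... | yes (u , _) = just u
  ... | no _        = nothing

  lowerPartner-sound : ∀ {u w} → lowerPartner w ≡ just u → LowerEdge u w
  lowerPartner-sound {w = w} eq with any? (λ u → lowerEdge? u w)
  lowerPartner-sound refl | yes (_ , e) = e

  lowerPartner-upper : ∀ {u w} → LowerEdge u w → lowerPartner w ≡ just u
  lowerPartner-upper {w = w} e with any? (λ u → lowerEdge? u w)
  ... | yes (_ , e′) = cong just (lowerEdge-unique e′ e)
  ... | no none      = ⊥-elim (none (_ , e))

  lowerPartner-lower : ∀ {u w} → LowerEdge u w → lowerPartner u ≡ nothing
  lowerPartner-lower {u} e with any? (λ u′ → lowerEdge? u′ u)
  ... | yes (_ , e′) = ⊥-elim (lowerEdge-no-chain e e′)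
  ... | no _         = refl

  -- Bag suc u of the path decomposition of cone M holds the apex, u unless u is the upper end
  -- of its matching edge, and the upper partner of u if there is one.
  bagOf : V M → V M
  bagOf w = fromMaybe w (lowerPartner w)

  bagOf-upper : ∀ {u w} → LowerEdge u w → bagOf w ≡ u
  bagOf-upper {w = w} e = cong (fromMaybe w) (lowerPartner-upper e)

  bagOf-lower : ∀ {u w} → LowerEdge u w → bagOf u ≡ u
  bagOf-lower {u} e = cong (fromMaybe u) (lowerPartner-lower e)

  δ-bagOf≤ : ∀ u w → δ (bagOf w) u ≤ δ w u + ⟦ adj M u w ⟧
  δ-bagOf≤ u w with lowerPartner w in eq
  ... | nothing = m≤m+n (δ w u) _
  ... | just u′ with u′ ≟ u
  ...   | no _     = z≤n
  ...   | yes refl =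
    subst (λ b → 1 ≤ δ w u′ + ⟦ b ⟧) (sym (proj₁ (lowerPartner-sound eq))) (m≤n+m 1 _)

  coneBag : V (cone M) → V (cone M) → Bool
  coneBag _       zero    = true
  coneBag zero    (suc _) = false
  coneBag (suc u) (suc w) = does (bagOf w ≟ u)

  coneBag-size : ∀ t → count (coneBag t) ≤ 3
  coneBag-size t = subst (_≤ 3) (sym (count≡∑ (coneBag t))) (bound t)
    where
    open ≤-Reasoning
    bound : ∀ t → ∑[ w < suc (n M) ] ⟦ coneBag t w ⟧ ≤ 3
    bound zero    = subst (λ k → suc k ≤ 3) (sym (sum-replicate-zero (n M))) (s≤s z≤n)
    bound (suc u) = s≤s (begin
      ∑[ w < n M ] δ (bagOf w) u
        ≤⟨ ∑-mono-≤ (δ-bagOf≤ u) ⟩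
      ∑[ w < n M ] (δ w u + ⟦ adj M u w ⟧)
        ≡⟨ ∑-distrib-+ (λ w → δ w u) (λ w → ⟦ adj M u w ⟧) ⟩
      ∑[ w < n M ] δ w u + ∑[ w < n M ] ⟦ adj M u w ⟧
        ≡⟨ cong₂ _+_ (∑-δ u) (sym (count≡∑ (adj M u))) ⟩
      1 + deg M u
        ≤⟨ s≤s (Δ≤1 u) ⟩
      2 ∎)

  coneBag-suc-unique : ∀ t w → coneBag t (suc w) ≡ true → t ≡ suc (bagOf w)
  coneBag-suc-unique (suc u) w e with bagOf w ≟ u
  coneBag-suc-unique (suc u) w _  | yes bw≡u = cong suc (sym bw≡u)
  coneBag-suc-unique (suc u) w () | no _

  cone-pw : PwLeq (cone M) 2
  cone-pw = suc (n M) , coneBag , cover , edges , interval , coneBag-size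
    where
    in-own-bag : ∀ w → coneBag (suc (bagOf w)) (suc w) ≡ true
    in-own-bag w = dec-true (bagOf w ≟ bagOf w) refl
    lowerEdge-bag : ∀ {u w} → LowerEdge u w →
                    coneBag (suc u) (suc u) ≡ true × coneBag (suc u) (suc w) ≡ true
    lowerEdge-bag {u} {w} e =
      dec-true (bagOf u ≟ u) (bagOf-lower e) , dec-true (bagOf w ≟ u) (bagOf-upper e)
    cover : ∀ v → ∃[ t ] coneBag t v ≡ true
    cover zero    = zero , refl
    cover (suc w) = suc (bagOf w) , in-own-bag w
    edges : ∀ u v → coneAdj M u v ≡ true → ∃[ t ] (coneBag t u ≡ true × coneBag t v ≡ true)
    edges zero    (suc w) _ = suc (bagOf w) , refl , in-own-bag w
    edges (suc w) zero    _ = suc (bagOf w) , in-own-bag w , refl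
    edges (suc u) (suc w) uw with edge-oriented uw
    ... | inj₁ e = suc u , lowerEdge-bag e
    ... | inj₂ e = suc w , swap (lowerEdge-bag e)
    interval : ∀ v (i j l : V (cone M)) → toℕ i ≤ toℕ j → toℕ j ≤ toℕ l →
               coneBag i v ≡ true → coneBag l v ≡ true → coneBag j v ≡ true
    interval zero    _ _ _ _   _   _   _   = refl
    interval (suc w) i j l i≤j j≤l i∋w l∋w =
      subst (λ t → coneBag t (suc w) ≡ true) (toℕ-injective i≡j) i∋w
      where
      l≡i : l ≡ i
      l≡i = trans (coneBag-suc-unique l w l∋w) (sym (coneBag-suc-unique i w i∋w))
      i≡j : toℕ i ≡ toℕ j
      i≡j = ≤-antisym i≤j (≤-trans j≤l (≤-reflexive (cong toℕ l≡i)))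

  coneParent : V (cone M) → Maybe (V (cone M))
  coneParent zero    = nothing
  coneParent (suc w) = just (maybe′ suc zero (lowerPartner w))

  coneParent-suc : ∀ {w p} → lowerPartner w ≡ p → coneParent (suc w) ≡ just (maybe′ suc zero p)
  coneParent-suc = cong (just ∘ maybe′ suc zero)

  coneParent-upper : ∀ {u w} → LowerEdge u w → coneParent (suc w) ≡ just (suc u)
  coneParent-upper e = coneParent-suc (lowerPartner-upper e)

  coneParent-lower : ∀ {u w} → LowerEdge u w → coneParent (suc u) ≡ just zero
  coneParent-lower e = coneParent-suc (lowerPartner-lower e)

  apex-ancestor : ∀ w → Ancestor coneParent zero (suc w)
  apex-ancestor w with lowerPartner w in eq
  ... | nothing = 1 , coneParent-suc eq
  ... | just _  = 2 , trans (cong (_>>= coneParent) (coneParent-suc eq)) (coneParent-lower (lowerPartner-sound eq))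

  cone-td : TdLeq (cone M) 3
  cone-td = coneParent , height , ancestor
    where
    height : ∀ v → up coneParent 3 v ≡ nothing
    height zero    = refl
    height (suc w) with lowerPartner w in eq
    ... | nothing = refl
    ... | just _  = cong (_>>= coneParent) (coneParent-lower (lowerPartner-sound eq))
    ancestor : ∀ u v → coneAdj M u v ≡ true → Ancestor coneParent u v ⊎ Ancestor coneParent v u
    ancestor zero    (suc w) _ = inj₁ (apex-ancestor w)
    ancestor (suc w) zero    _ = inj₂ (apex-ancestor w)
    ancestor (suc u) (suc w) uw with edge-oriented uw
    ... | inj₁ e = inj₁ (1 , coneParent-upper e)
    ... | inj₂ e = inj₂ (1 , coneParent-upper e)

-- Paths are trees

Consecutive : ℕ → ℕ → Set
Consecutive a b = suc a ≡ b ⊎ suc b ≡ a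

far-apart : ∀ k {a b} → suc (suc k) + a ≡ b → ¬ Consecutive a b
far-apart k gap (inj₁ e) = m≢1+n+m _ (suc-injective (trans e (sym gap)))
far-apart k gap (inj₂ e) = m≢1+n+m _ (trans (sym e) (cong suc (sym gap)))

pathAdj : ∀ {m} → Fin m → Fin m → Bool
pathAdj i j = (suc (toℕ i) ≡ᵇ toℕ j) ∨ (suc (toℕ j) ≡ᵇ toℕ i)

pathAdj⇒consecutive : ∀ {m} {i j : Fin m} → pathAdj i j ≡ true → Consecutive (toℕ i) (toℕ j)
pathAdj⇒consecutive e =
  Sum.map (≡ᵇ⇒≡ _ _) (≡ᵇ⇒≡ _ _) (Equivalence.to T-∨ (Equivalence.from T-≡ e))

pathAdj-suc : ∀ {m} {i j : Fin m} → suc (toℕ i) ≡ toℕ j → pathAdj i j ≡ true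
pathAdj-suc e = Equivalence.to T-≡ (Equivalence.from T-∨ (inj₁ (≡⇒≡ᵇ _ _ e)))

path : ℕ → Graph
path m = record
  { n      = m
  ; adj    = pathAdj
  ; sym    = λ i j → ∨-comm (suc (toℕ i) ≡ᵇ toℕ j) (suc (toℕ j) ≡ᵇ toℕ i)
  ; irrefl = λ i → ¬-not (λ e → [ 1+n≢n , 1+n≢n ] (pathAdj⇒consecutive {i = i} {i} e))
  }

-- g lists the labels along a closed walk of length 3 + l in a path.  Since a step cannot
-- undo the previous one, the labels move monotonically, so the closing step would have to
-- span a distance of 2 + l.
module _ {l} (g : ℕ → ℕ)
  (step      : ∀ {i} → suc i < 3 + l → Consecutive (g i) (g (suc i)))
  (no-return : ∀ {i} → suc (suc i) < 3 + l → g (suc (suc i)) ≢ g i)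
  where

  private
    ascending : suc (g 0) ≡ g 1 → ∀ {i} → suc i < 3 + l → suc (g i) ≡ g (suc i)
    ascending up {zero}  _  = up
    ascending up {suc i} lt with step lt
    ... | inj₁ e = e
    ... | inj₂ e =
      ⊥-elim (no-return lt (suc-injective (trans e (sym (ascending up (≤-trans (n≤1+n _) lt))))))

    ascending-offset : suc (g 0) ≡ g 1 → ∀ {i} → i < 3 + l → i + g 0 ≡ g i
    ascending-offset up {zero}  _  = refl
    ascending-offset up {suc i} lt =
      trans (cong suc (ascending-offset up (≤-trans (n≤1+n _) lt))) (ascending up lt)

    descending : suc (g 1) ≡ g 0 → ∀ {i} → suc i < 3 + l → suc (g (suc i)) ≡ g i
    descending down {zero}  _  = down
    descending down {suc i} lt with step lt
    ... | inj₂ e = e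
    ... | inj₁ e = ⊥-elim (no-return lt (trans (sym e) (descending down (≤-trans (n≤1+n _) lt))))

    descending-offset : suc (g 1) ≡ g 0 → ∀ {i} → i < 3 + l → i + g i ≡ g 0
    descending-offset down {zero}  _  = refl
    descending-offset down {suc i} lt = begin
      suc i + g (suc i)    ≡⟨ +-suc i (g (suc i)) ⟨
      i + suc (g (suc i))  ≡⟨ cong (i +_) (descending down lt) ⟩
      i + g i              ≡⟨ descending-offset down (≤-trans (n≤1+n _) lt) ⟩
      g 0                  ∎
      where open ≡-Reasoning

  not-closed : ¬ Consecutive (g (2 + l)) (g 0)
  not-closed close with step {0} (s≤s (s≤s z≤n))
  ... | inj₁ up   = far-apart l (ascending-offset up ≤-refl) (Sum.swap close)
  ... | inj₂ down = far-apart l (descending-offset down ≤-refl) close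

path-acyclic : ∀ m → ¬ Cycle (path m)
path-acyclic m (l , c , c-injective , c-step , c-close) = not-closed g step no-return close
  where
  L = 3 + l
  g : ℕ → ℕ
  g i = toℕ (c (i mod L))
  toℕ-mod : ∀ {i} → i < L → toℕ (i mod L) ≡ i
  toℕ-mod i<L = trans (toℕ-fromℕ< _) (m<n⇒m%n≡m i<L)
  g-at : ∀ x {i} → toℕ x ≡ i → g i ≡ toℕ (c x)
  g-at x refl = cong (toℕ ∘ c) (toℕ-injective (toℕ-mod (toℕ<n x)))
  step : ∀ {i} → suc i < L → Consecutive (g i) (g (suc i))
  step lt = subst₂ Consecutive (sym (g-at (inject₁ k) (trans (toℕ-inject₁ k) (toℕ-fromℕ< _))))
                               (sym (g-at (suc k) (cong suc (toℕ-fromℕ< _))))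
                               (pathAdj⇒consecutive (c-step k))
    where k = fromℕ< (s≤s⁻¹ lt)
  close : Consecutive (g (2 + l)) (g 0)
  close = subst₂ Consecutive (sym (g-at (fromℕ (2 + l)) (toℕ-fromℕ _))) (sym (g-at zero refl))
                             (pathAdj⇒consecutive c-close)
  no-return : ∀ {i} → suc (suc i) < L → g (suc (suc i)) ≢ g i
  no-return {i} lt e = m≢1+n+m i (sym (begin
    suc (suc i)              ≡⟨ toℕ-mod lt ⟨
    toℕ (suc (suc i) mod L)  ≡⟨ cong toℕ (c-injective (toℕ-injective e)) ⟩
    toℕ (i mod L)            ≡⟨ toℕ-mod (≤-trans (n≤1+n _) (≤-trans (n≤1+n _) lt)) ⟩
    i                        ∎))
    where open ≡-Reasoning

StepIn-sym : ∀ T S {x y} → StepIn T S x y → StepIn T S y x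
StepIn-sym T S (sx , sy , xy) = sy , sx , trans (adj-sym T _ _) xy

module _ {m} (S : Fin m → Bool)
  (convex : ∀ i j k → toℕ i ≤ toℕ j → toℕ j ≤ toℕ k →
            S i ≡ true → S k ≡ true → S j ≡ true)
  where

  private
    walk-up : ∀ d {x y} → d + toℕ x ≡ toℕ y →
              S x ≡ true → S y ≡ true → Star (StepIn (path m) S) x y
    walk-up zero    x≡y _  _ with toℕ-injective x≡y
    ... | refl = ε
    walk-up (suc d) {x} {y} gap sx sy = (sx , sx′ , pathAdj-suc (sym toℕ-x′)) ◅ walk-up d gap′ sx′ sy
      where
      x<y : suc (toℕ x) ≤ toℕ y
      x<y = subst (suc (toℕ x) ≤_) gap (s≤s (m≤n+m (toℕ x) d))
      x′ : Fin m
      x′ = fromℕ< (≤-<-trans x<y (toℕ<n y))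
      toℕ-x′ : toℕ x′ ≡ suc (toℕ x)
      toℕ-x′ = toℕ-fromℕ< _
      gap′ : d + toℕ x′ ≡ toℕ y
      gap′ = trans (cong (d +_) toℕ-x′) (trans (+-suc d (toℕ x)) gap)
      sx′ : S x′ ≡ true
      sx′ = convex x x′ y (≤-trans (n≤1+n _) (≤-reflexive (sym toℕ-x′)))
                          (≤-trans (≤-reflexive toℕ-x′) x<y) sx sy

  interval-connected : ∀ x y → S x ≡ true → S y ≡ true → Star (StepIn (path m) S) x y
  interval-connected x y sx sy with ≤-total (toℕ x) (toℕ y)
  ... | inj₁ x≤y = walk-up _ (m∸n+n≡m x≤y) sx sy
  ... | inj₂ y≤x = Star.reverse (StepIn-sym (path m) S) (walk-up _ (m∸n+n≡m y≤x) sy sx)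

path-isTree : ∀ m → IsTree (path (suc m))
path-isTree m =
  ((zero , refl) , interval-connected (λ _ → true) (λ _ _ _ _ _ _ _ → refl)) , path-acyclic (suc m)

pw⇒tw : ∀ H k → PwLeq H k → TwLeq H k
pw⇒tw H k (zero , _ , cover , _) =
  path 1 , path-isTree 0 , (λ _ _ → false) ,
  (λ v → ⊥-elim (no-bag v)) , (λ u _ _ → ⊥-elim (no-bag u)) , (λ v → ⊥-elim (no-bag v)) ,
  (λ _ → subst (_≤ suc k) (sym (trans (count≡∑ {n H} (λ _ → false)) (sum-replicate-zero (n H)))) z≤n)
  where
  no-bag : V H → ⊥
  no-bag v with cover v
  ... | () , _
pw⇒tw H k (suc m , B , cover , edges , convex , size) =
  path (suc m) , path-isTree m , B , cover , edges ,
  (λ v → cover v , interval-connected (λ t → B t v) (convex v)) , size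

ProdLeq-map : ∀ {f g : Graph → ℕ → Set} → (∀ H k → f H k → g H k) →
  ∀ G k → ProdLeq f G k → ProdLeq g G k
ProdLeq-map f⇒g G k (H₁ , H₂ , f₁ , f₂ , G⊆H₁⊠H₂) =
  H₁ , H₂ , f⇒g H₁ k f₁ , f⇒g H₂ k f₂ , G⊆H₁⊠H₂

-- Embedding into the strong product of two cones

adj⇒≢ : ∀ G {u v} → adj G u v ≡ true → u ≢ v
adj⇒≢ G {u} uv refl with trans (sym uv) (irrefl G u)
... | ()

module _ (G : Graph) (c : V G → Bool) where

  -- The conjunct monoAdj, redundant next to the colour tests, makes the degree bound pointwise.
  classAdj : Bool → V G → V G → Bool
  classAdj b u w = monoAdj G c u w ∧ (not (c u xor b) ∧ not (c w xor b))

  colourClass : Bool → Graph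
  colourClass b = record
    { n      = n G
    ; adj    = classAdj b
    ; sym    = λ u w → cong₂ _∧_ (monoAdj-sym G c u w) (∧-comm (not (c u xor b)) (not (c w xor b)))
    ; irrefl = λ u → cong (λ e → (e ∧ not (c u xor c u)) ∧ (not (c u xor b) ∧ not (c u xor b)))
                          (irrefl G u)
    }

  colourClass-Δ≤ : ∀ {d} → (∀ v → monoDeg G c v ≤ d) → ∀ b → MaxDegLeq (colourClass b) d
  colourClass-Δ≤ {d} mono≤ b v = begin
    deg (colourClass b) v           ≡⟨ count≡∑ (classAdj b v) ⟩
    ∑[ w < n G ] ⟦ classAdj b v w ⟧  ≤⟨ ∑-mono-≤ (λ w → ⟦∧⟧≤ (monoAdj G c v w) _) ⟩
    monoDeg G c v                   ≤⟨ mono≤ v ⟩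
    d                               ∎
    where open ≤-Reasoning

  classAdj-intro : ∀ {b u w} → c u ≡ b → c w ≡ b → adj G u w ≡ true → classAdj b u w ≡ true
  classAdj-intro {b} refl cw uw rewrite cw | uw | xor-same b = refl

  place : Bool → V G → V (cone (colourClass false)) × V (cone (colourClass true))
  place false v = suc v , zero
  place true  v = zero  , suc v

  place-injective : ∀ a b {u v} → place a u ≡ place b v → u ≡ v
  place-injective false false refl = refl
  place-injective true  true  refl = refl

  place-adj : ∀ {u v} a b → c u ≡ a → c v ≡ b → adj G u v ≡ true →
              ⊠-adj (cone (colourClass false)) (cone (colourClass true)) (place a u) (place b v)
  place-adj false false cu cv uv =
    (λ eq → adj⇒≢ G uv (Fin.suc-injective (cong proj₁ eq))) , inj₂ (classAdj-intro cu cv uv) , inj₁ refl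
  place-adj true  true  cu cv uv =
    (λ eq → adj⇒≢ G uv (Fin.suc-injective (cong proj₂ eq))) , inj₁ refl , inj₂ (classAdj-intro cu cv uv)
  place-adj false true  _  _  _  = (λ ()) , inj₂ refl , inj₂ refl
  place-adj true  false _  _  _  = (λ ()) , inj₂ refl , inj₂ refl

  ⊆-cone⊠cone : SubgraphOfStrongProduct G (cone (colourClass false)) (cone (colourClass true))
  ⊆-cone⊠cone = (λ v → place (c v) v) , (λ {u} {v} → place-injective (c u) (c v)) ,
                (λ u v → place-adj (c u) (c v) refl refl)

proposition19 : (G : Graph) → MaxDegLeq G 3 →
    (Σ Graph λ H₁ → Σ Graph λ H₂ →
    Windmill H₁ × Windmill H₂ × SubgraphOfStrongProduct G H₁ H₂) ×
    ((∀ k → ProdLeq PwLeq G k → ProdLeq TwLeq G k) ×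
    ProdLeq TwLeq G 2 ×
    ProdLeq PwLeq G 2 ×
    ProdLeq TdLeq G 3)
proposition19 G Δ≤3 =
  (H₁ , H₂ , cone-windmill _ (Δ≤1 false) , cone-windmill _ (Δ≤1 true) , ⊆-cone⊠cone G c) ,
  ProdLeq-map pw⇒tw G ,
  ProdLeq-map pw⇒tw G 2 pw≤2 ,
  pw≤2 ,
  (H₁ , H₂ , cone-td _ (Δ≤1 false) , cone-td _ (Δ≤1 true) , ⊆-cone⊠cone G c)
  where
  c : V G → Bool
  c = proj₁ (lovász-colouring G 1 Δ≤3)
  Δ≤1 : ∀ b → MaxDegLeq (colourClass G c b) 1
  Δ≤1 = colourClass-Δ≤ G c (proj₂ (lovász-colouring G 1 Δ≤3))
  H₁ H₂ : Graph
  H₁ = cone (colourClass G c false)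
  H₂ = cone (colourClass G c true)
  pw≤2 : ProdLeq PwLeq G 2
  pw≤2 = H₁ , H₂ , cone-pw _ (Δ≤1 false) , cone-pw _ (Δ≤1 true) , ⊆-cone⊠cone G c
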